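{- Let $\nu$ be a lattice path from $(0,0)$ to $(s_E,s_N)$, let $D$ be a $\nu$-Dyck path, and let $\sigma_\nu$ be the size of the maximal staircase shape $\nu$-Dyck path. Then the out-degree of $D$ in the $\nu$-Tamari poset equals $\sigma_\nu$ if and only if there are $\sigma_\nu$ indices $i\in[s_N]$ such that $r_i^D$ is preceded by an east step in $D$.
   Context: Let $\nu$ be a lattice path from $(0,0)$ to $(s_E,s_N)$ with unit north ($N$) and east ($E$) steps. A $\nu$-Dyck path is a lattice path from $(0,0)$ to $(s_E,s_N)$ with $N$ and $E$ steps lying weakly above $\nu$; $\mathcal D_\nu$ is the set of them. For $i\in[s_N]$, $r_i^D$ is the point of $D$ immediately before the $i$-th north step. For $p=(x,y)$ on $D$, $\mathrm{horiz}_\nu(p)=X(y)-x$ with $X(y)$ the largest $x$-coordinate of a point of $\nu$ at height $y$. The touch point $t_i^D$ is the first point of $D$ after $r_i^D$ with the same horizontal distance as $r_i^D$. If $r_i^D$ is preceded by an east step, write $D=dEtf$ ($dE$ = subpath from $(0,0)$ to $r_i^D$, $t$ = subpath from $r_i^D$ to $t_i^D$, $f$ = the rest) and set $D\uparrow_i=dtEf$. The $\nu$-Tamari order $\le_T$ is the partial order on $\mathcal D_\nu$ whose cover relations are $D\lessdot_T D\uparrow_i$ whenever defined. The out-degree of $D$ is the number of elements covering $D$ in this poset. A $\nu$-Dyck path is a staircase shape of size $k$ if it equals $N^a(EN)^kE^b$ for some $a,b\ge 0$; $\sigma_\nu$ is the largest $k$ for which such a $\nu$-Dyck path exists. -}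

module Defs where

open import Data.Nat using (ℕ; zero; suc; _+_; _∸_; _≤_; _⊔_; _≡ᵇ_)
open import Data.Nat.Properties using (_≟_)
open import Data.Bool using (Bool; true; false; if_then_else_; _∧_)
open import Data.Product using (_×_; _,_; ∃; ∃-syntax; proj₁; proj₂)
open import Data.List using (List; []; _∷_; _++_; length; take; drop; replicate; concat; map; upTo; mapMaybe; filterᵇ; deduplicate)
open import Data.List.Relation.Unary.All using (All)
open import Data.Maybe using (Maybe; just; nothing)
open import Relation.Binary.PropositionalEquality using (_≡_; refl)
open import Relation.Nullary using (Dec; yes; no)
open import Relation.Binary using (DecidableEquality)
import Data.List.Properties as LP

data Step : Set where
  N E : Step

_≟S_ : DecidableEquality Step
N ≟S N = yes refl
E ≟S E = yes refl
N ≟S E = no λ ()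
E ≟S N = no λ ()

_≟P_ : DecidableEquality (List Step)
_≟P_ = LP.≡-dec _≟S_

Path : Set
Path = List Step

numN : Path → ℕ
numN [] = 0
numN (N ∷ p) = suc (numN p)
numN (E ∷ p) = numN p

numE : Path → ℕ
numE [] = 0
numE (E ∷ p) = suc (numE p)
numE (N ∷ p) = numE p

Point : Set
Point = ℕ × ℕ

pointsFrom : Point → Path → List Point
pointsFrom (x , y) [] = (x , y) ∷ []
pointsFrom (x , y) (N ∷ s) = (x , y) ∷ pointsFrom (x , suc y) s
pointsFrom (x , y) (E ∷ s) = (x , y) ∷ pointsFrom (suc x , y) s

points : Path → List Point
points = pointsFrom (0 , 0)

-- X(y): largest x-coordinate of a point of ν at height y
-- (only used for 0 ≤ y ≤ s_N, where such a point exists)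
maxXAt : ℕ → List Point → ℕ
maxXAt y [] = 0
maxXAt y ((x , y') ∷ ps) = if y ≡ᵇ y' then x ⊔ maxXAt y ps else maxXAt y ps

X : Path → ℕ → ℕ
X ν y = maxXAt y (points ν)

-- horiz_ν(p) = X(y) - x  (nonnegative for points of ν-Dyck paths)
horiz : Path → Point → ℕ
horiz ν (x , y) = X ν y ∸ x

IsDyck : Path → Path → Set
IsDyck ν D = (numN D ≡ numN ν) × (numE D ≡ numE ν)
             × All (λ p → proj₁ p ≤ X ν (proj₂ p)) (points D)

at : {A : Set} → List A → ℕ → Maybe A
at [] _ = nothing
at (a ∷ as) zero = just a
at (a ∷ as) (suc n) = at as n

-- 0-based index (in the step list) of the i-th north step, i ≥ 1
nthNFrom : ℕ → ℕ → Path → Maybe ℕ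
nthNFrom i j [] = nothing
nthNFrom zero j (s ∷ p) = nothing
nthNFrom (suc zero) j (N ∷ p) = just j
nthNFrom (suc (suc i)) j (N ∷ p) = nthNFrom (suc i) (suc j) p
nthNFrom (suc i) j (E ∷ p) = nthNFrom (suc i) (suc j) p

nthN : ℕ → Path → Maybe ℕ
nthN i = nthNFrom i 0

-- r_i^D is the point with index j = nthN i D in (points D);
-- it is preceded by an east step iff j ≥ 1 and step j-1 is E.
precededByE : Path → ℕ → Bool
precededByE D i with nthN i D
... | nothing = false
... | just zero = false
... | just (suc j) with at D j
...   | just E = true
...   | _ = false

firstWithHoriz : Path → ℕ → ℕ → List Point → Maybe ℕ
firstWithHoriz ν h k [] = nothing
firstWithHoriz ν h k (p ∷ ps) =
  if horiz ν p ≡ᵇ h then just k else firstWithHoriz ν h (suc k) ps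

touchIndex : Path → Path → ℕ → Maybe ℕ
touchIndex ν D j with at (points D) j
... | nothing = nothing
... | just r = firstWithHoriz ν (horiz ν r) (suc j) (drop (suc j) (points D))

-- D = d E t f  ↦  D↑i = d t E f   (defined only if r_i^D is preceded by E)
rotate : Path → Path → ℕ → Maybe Path
rotate ν D i with nthN i D
... | nothing = nothing
... | just zero = nothing
... | just (suc j) with at D j
...   | just N = nothing
...   | nothing = nothing
...   | just E with touchIndex ν D (suc j)
...     | nothing = nothing
...     | just k = just (take j D ++ drop (suc j) (take k D) ++ (E ∷ drop k D))

indices : Path → List ℕ
indices ν = map suc (upTo (numN ν))

-- the elements covering D in the ν-Tamari poset: the distinct D↑i
covers : Path → Path → List Path
covers ν D = deduplicate _≟P_ (mapMaybe (rotate ν D) (indices ν))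

outDegree : Path → Path → ℕ
outDegree ν D = length (covers ν D)

numEastPreceded : Path → Path → ℕ
numEastPreceded ν D = length (filterᵇ (precededByE D) (indices ν))

staircase : ℕ → ℕ → ℕ → Path
staircase a k b = replicate a N ++ concat (replicate k (E ∷ N ∷ [])) ++ replicate b E

HasStaircaseOfSize : Path → ℕ → Set
HasStaircaseOfSize ν k = ∃[ a ] ∃[ b ] IsDyck ν (staircase a k b)

IsSigma : Path → ℕ → Set
IsSigma ν σ = HasStaircaseOfSize ν σ × ((k : ℕ) → HasStaircaseOfSize ν k → k ≤ σ)

-- A north step preceded by an east step can always be rotated: along D the horizontal
-- distance to ν does not decrease at north steps, drops by exactly one at east steps while
-- positive, and is 0 at the common endpoint, so after r_i^D it takes the value horiz(r_i^D)
-- again and the touch point t_i^D exists. Distinct such indices give distinct covers, since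
-- D↑i agrees with D before the east step preceding r_i^D and has a north step in its place.
-- Hence the out-degree of every ν-Dyck path is the number of such indices.
module Submission where

open import Data.Bool using (Bool; true; false; T)
open import Data.Empty using (⊥-elim)
open import Data.List using (List; []; _∷_; _++_; length; take; drop; filter; filterᵇ; mapMaybe; deduplicate)
open import Data.List.Properties using (filter-all)
open import Data.List.Relation.Unary.All using (All; []; _∷_)
open import Data.List.Relation.Unary.AllPairs using ([]; _∷_)
open import Data.List.Relation.Unary.Any using (Any; here; there)
open import Data.List.Relation.Unary.Unique.Propositional using (Unique)
import Data.List.Relation.Unary.Unique.Propositional.Properties as Unique
open import Data.Maybe using (Maybe; just; nothing; is-just)
open import Data.Maybe.Properties using (just-injective)
open import Data.Nat using (ℕ; zero; suc; _+_; _⊔_; _≤_; _<_; _≡ᵇ_; z≤n; s≤s)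
open import Data.Nat.Properties
open import Data.Product using (_×_; _,_; proj₁; ∃-syntax)
open import Data.Sum using (inj₁; inj₂)
open import Data.Unit using (tt)
open import Function using (_∘_)
open import Function.Bundles using (_⇔_; mk⇔)
open import Relation.Binary using (DecidableEquality)
open import Relation.Binary.PropositionalEquality
open import Relation.Nullary using (¬?; yes; no)

open import Defs

maxXAt-here : ∀ {y} x ps → maxXAt y ((x , y) ∷ ps) ≡ x ⊔ maxXAt y ps
maxXAt-here {y} x ps with y ≡ᵇ y | ≡⇒≡ᵇ y y refl
... | true | _ = refl

maxXAt-other : ∀ {y y'} x ps → y ≢ y' → maxXAt y ((x , y') ∷ ps) ≡ maxXAt y ps
maxXAt-other {y} {y'} x ps y≢y' with y ≡ᵇ y' in eq
... | true  = ⊥-elim (y≢y' (≡ᵇ⇒≡ y y' (subst T (sym eq) tt)))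
... | false = refl

maxXAt-lub : ∀ {b} y ps → All (λ p → proj₁ p ≤ b) ps → maxXAt y ps ≤ b
maxXAt-lub y [] [] = z≤n
maxXAt-lub y ((x , y') ∷ ps) (x≤b ∷ ps≤b) with y ≡ᵇ y'
... | true  = ⊔-lub x≤b (maxXAt-lub y ps ps≤b)
... | false = maxXAt-lub y ps ps≤b

pointsFrom-x≤end : ∀ s {x₀ y₀} → All (λ p → proj₁ p ≤ numE s + x₀) (pointsFrom (x₀ , y₀) s)
pointsFrom-x≤end [] = ≤-refl ∷ []
pointsFrom-x≤end (N ∷ s) {x₀} = m≤n+m x₀ (numE s) ∷ pointsFrom-x≤end s
pointsFrom-x≤end (E ∷ s) {x₀} rewrite sym (+-suc (numE s) x₀) =
  ≤-trans (n≤1+n x₀) (m≤n+m (suc x₀) (numE s)) ∷ pointsFrom-x≤end s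

maxXAt-below : ∀ s {x₀ y₀ y} → y < y₀ → maxXAt y (pointsFrom (x₀ , y₀) s) ≡ 0
maxXAt-below [] {x₀} y<y₀ = maxXAt-other x₀ [] (<⇒≢ y<y₀)
maxXAt-below (N ∷ s) {x₀} {y₀} y<y₀ =
  trans (maxXAt-other x₀ (pointsFrom (x₀ , suc y₀) s) (<⇒≢ y<y₀)) (maxXAt-below s (m<n⇒m<1+n y<y₀))
maxXAt-below (E ∷ s) {x₀} {y₀} y<y₀ =
  trans (maxXAt-other x₀ (pointsFrom (suc x₀ , y₀) s) (<⇒≢ y<y₀)) (maxXAt-below s y<y₀)

start≤maxXAt-start : ∀ s {x₀ y₀} → x₀ ≤ maxXAt y₀ (pointsFrom (x₀ , y₀) s)
start≤maxXAt-start [] {x₀} {y₀} =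
  ≤-reflexive (sym (trans (maxXAt-here {y₀} x₀ []) (⊔-identityʳ x₀)))
start≤maxXAt-start (N ∷ s) {x₀} {y₀} =
  subst (x₀ ≤_) (sym (maxXAt-here x₀ (pointsFrom (x₀ , suc y₀) s))) (m≤m⊔n x₀ _)
start≤maxXAt-start (E ∷ s) {x₀} {y₀} =
  subst (x₀ ≤_) (sym (maxXAt-here x₀ (pointsFrom (suc x₀ , y₀) s))) (m≤m⊔n x₀ _)

start≤maxXAt : ∀ s {x₀ y₀ y} → y₀ ≤ y → y ≤ numN s + y₀ → x₀ ≤ maxXAt y (pointsFrom (x₀ , y₀) s)
start≤maxXAt s y₀≤y y≤top with m≤n⇒m<n∨m≡n y₀≤y
... | inj₂ refl = start≤maxXAt-start s
start≤maxXAt [] _ y≤top | inj₁ y₀<y = ⊥-elim (<⇒≱ y₀<y y≤top)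
start≤maxXAt (N ∷ s) {x₀} {y₀} _ y≤top | inj₁ y₀<y =
  subst (x₀ ≤_) (sym (maxXAt-other x₀ (pointsFrom (x₀ , suc y₀) s) (>⇒≢ y₀<y)))
    (start≤maxXAt s y₀<y (≤-trans y≤top (≤-reflexive (sym (+-suc (numN s) y₀)))))
start≤maxXAt (E ∷ s) {x₀} {y₀} _ y≤top | inj₁ y₀<y =
  subst (x₀ ≤_) (sym (maxXAt-other x₀ (pointsFrom (suc x₀ , y₀) s) (>⇒≢ y₀<y)))
    (≤-trans (n≤1+n x₀) (start≤maxXAt s (<⇒≤ y₀<y) y≤top))

maxXAt-suc-mono : ∀ s {x₀ y₀ y} → y₀ ≤ y → y < numN s + y₀ →
                  maxXAt y (pointsFrom (x₀ , y₀) s) ≤ maxXAt (suc y) (pointsFrom (x₀ , y₀) s)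
maxXAt-suc-mono [] y₀≤y y<top = ⊥-elim (<⇒≱ y<top y₀≤y)
maxXAt-suc-mono (N ∷ s) {x₀} {y₀} {y} y₀≤y y<top with m≤n⇒m<n∨m≡n y₀≤y
... | inj₂ refl = begin
  maxXAt y (pointsFrom (x₀ , y) (N ∷ s))       ≡⟨ maxXAt-here x₀ rest ⟩
  x₀ ⊔ maxXAt y rest                           ≡⟨ cong (x₀ ⊔_) (maxXAt-below s ≤-refl) ⟩
  x₀ ⊔ 0                                       ≡⟨ ⊔-identityʳ x₀ ⟩
  x₀                                           ≤⟨ start≤maxXAt-start s ⟩
  maxXAt (suc y) rest                          ≡⟨ maxXAt-other x₀ rest 1+n≢n ⟨
  maxXAt (suc y) (pointsFrom (x₀ , y) (N ∷ s)) ∎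
  where
  open ≤-Reasoning
  rest : List Point
  rest = pointsFrom (x₀ , suc y) s
... | inj₁ y₀<y = begin
  maxXAt y (pointsFrom (x₀ , y₀) (N ∷ s))       ≡⟨ maxXAt-other x₀ rest (>⇒≢ y₀<y) ⟩
  maxXAt y rest                                 ≤⟨ maxXAt-suc-mono s y₀<y y<top' ⟩
  maxXAt (suc y) rest                           ≡⟨ maxXAt-other x₀ rest (>⇒≢ (m<n⇒m<1+n y₀<y)) ⟨
  maxXAt (suc y) (pointsFrom (x₀ , y₀) (N ∷ s)) ∎
  where
  open ≤-Reasoning
  rest : List Point
  rest = pointsFrom (x₀ , suc y₀) s
  y<top' : y < numN s + suc y₀
  y<top' = ≤-trans y<top (≤-reflexive (sym (+-suc (numN s) y₀)))
maxXAt-suc-mono (E ∷ s) {x₀} {y₀} {y} y₀≤y y<top with m≤n⇒m<n∨m≡n y₀≤y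
... | inj₂ refl = begin
  maxXAt y (pointsFrom (x₀ , y) (E ∷ s))       ≡⟨ maxXAt-here x₀ rest ⟩
  x₀ ⊔ maxXAt y rest                           ≤⟨ ⊔-lub x₀≤ (maxXAt-suc-mono s ≤-refl y<top) ⟩
  maxXAt (suc y) rest                          ≡⟨ maxXAt-other x₀ rest 1+n≢n ⟨
  maxXAt (suc y) (pointsFrom (x₀ , y) (E ∷ s)) ∎
  where
  open ≤-Reasoning
  rest : List Point
  rest = pointsFrom (suc x₀ , y) s
  x₀≤ : x₀ ≤ maxXAt (suc y) rest
  x₀≤ = ≤-trans (n≤1+n x₀) (start≤maxXAt s (n≤1+n y) y<top)
... | inj₁ y₀<y = begin
  maxXAt y (pointsFrom (x₀ , y₀) (E ∷ s))       ≡⟨ maxXAt-other x₀ rest (>⇒≢ y₀<y) ⟩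
  maxXAt y rest                                 ≤⟨ maxXAt-suc-mono s y₀≤y y<top ⟩
  maxXAt (suc y) rest                           ≡⟨ maxXAt-other x₀ rest (>⇒≢ (m<n⇒m<1+n y₀<y)) ⟨
  maxXAt (suc y) (pointsFrom (x₀ , y₀) (E ∷ s)) ∎
  where
  open ≤-Reasoning
  rest : List Point
  rest = pointsFrom (suc x₀ , y₀) s

X-suc-mono : ∀ ν {y} → y < numN ν → X ν y ≤ X ν (suc y)
X-suc-mono ν y<top =
  maxXAt-suc-mono ν z≤n (≤-trans y<top (≤-reflexive (sym (+-identityʳ (numN ν)))))

X-top≤numE : ∀ ν → X ν (numN ν) ≤ numE ν
X-top≤numE ν =
  subst (X ν (numN ν) ≤_) (+-identityʳ (numE ν)) (maxXAt-lub (numN ν) (points ν) (pointsFrom-x≤end ν))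

horiz-end : ∀ ν {x y} → x ≡ numE ν → y ≡ numN ν → horiz ν (x , y) ≡ 0
horiz-end ν refl refl = m≤n⇒m∸n≡0 (X-top≤numE ν)

horiz-attains : ∀ ν s {x y h} → numE s + x ≡ numE ν → numN s + y ≡ numN ν → h ≤ horiz ν (x , y) →
                Any (λ p → horiz ν p ≡ h) (pointsFrom (x , y) s)
horiz-attains ν [] {x} {y} {h} x≡ y≡ h≤ =
  here (trans horiz≡0 (sym (n≤0⇒n≡0 (subst (h ≤_) horiz≡0 h≤))))
  where
  horiz≡0 : horiz ν (x , y) ≡ 0
  horiz≡0 = horiz-end ν x≡ y≡
horiz-attains ν (N ∷ s) {x} {y} x≡ y≡ h≤ =
  there (horiz-attains ν s x≡ (trans (+-suc (numN s) y) y≡)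
    (≤-trans h≤ (∸-monoˡ-≤ x (X-suc-mono ν y<top))))
  where
  y<top : y < numN ν
  y<top = ≤-trans (s≤s (m≤n+m y (numN s))) (≤-reflexive y≡)
horiz-attains ν (E ∷ s) {x} {y} {h} x≡ y≡ h≤ with horiz ν (x , y) ≟ h
... | yes horiz≡h = here horiz≡h
... | no  horiz≢h =
  there (horiz-attains ν s (trans (+-suc (numE s) x) x≡) y≡
    (subst (h ≤_) (pred[m∸n]≡m∸[1+n] (X ν y) x) (pred-mono-≤ (≤∧≢⇒< h≤ (horiz≢h ∘ sym)))))

horiz-recurs-after-N : ∀ ν s n {x y} → at s n ≡ just N → numE s + x ≡ numE ν → numN s + y ≡ numN ν →
  ∃[ r ] at (pointsFrom (x , y) s) n ≡ just r
       × Any (λ p → horiz ν p ≡ horiz ν r) (drop (suc n) (pointsFrom (x , y) s))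
horiz-recurs-after-N ν (N ∷ s) zero {x} {y} refl x≡ y≡ =
  (x , y) , refl ,
  horiz-attains ν s x≡ (trans (+-suc (numN s) y) y≡) (∸-monoˡ-≤ x (X-suc-mono ν y<top))
  where
  y<top : y < numN ν
  y<top = ≤-trans (s≤s (m≤n+m y (numN s))) (≤-reflexive y≡)
horiz-recurs-after-N ν (N ∷ s) (suc n) {x} {y} sₙ≡N x≡ y≡ =
  horiz-recurs-after-N ν s n sₙ≡N x≡ (trans (+-suc (numN s) y) y≡)
horiz-recurs-after-N ν (E ∷ s) (suc n) {x} sₙ≡N x≡ y≡ =
  horiz-recurs-after-N ν s n sₙ≡N (trans (+-suc (numE s) x) x≡) y≡

firstWithHoriz-just : ∀ ν h ps k → Any (λ p → horiz ν p ≡ h) ps →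
                      ∃[ k' ] firstWithHoriz ν h k ps ≡ just k' × k ≤ k'
firstWithHoriz-just ν h (p ∷ ps) k any with horiz ν p ≡ᵇ h in eq
... | true = k , refl , ≤-refl
firstWithHoriz-just ν h (p ∷ ps) k (here horiz≡h) | false =
  ⊥-elim (subst T eq (≡⇒≡ᵇ (horiz ν p) h horiz≡h))
firstWithHoriz-just ν h (p ∷ ps) k (there any) | false with firstWithHoriz-just ν h ps (suc k) any
... | k' , found , k<k' = k' , found , <⇒≤ k<k'

touchIndex-after-N : ∀ ν D j → at D j ≡ just N → numE D ≡ numE ν → numN D ≡ numN ν →
                     ∃[ k ] touchIndex ν D j ≡ just k × j < k
touchIndex-after-N ν D j Dⱼ≡N eE eN
  with horiz-recurs-after-N ν D j Dⱼ≡N (trans (+-identityʳ _) eE) (trans (+-identityʳ _) eN)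
... | r , rⱼ , recurs rewrite rⱼ =
  firstWithHoriz-just ν (horiz ν r) (drop (suc j) (points D)) (suc j) recurs

nthNFrom-E : ∀ i c D → nthNFrom i c (E ∷ D) ≡ nthNFrom i (suc c) D
nthNFrom-E zero c []            = refl
nthNFrom-E zero c (_ ∷ _)       = refl
nthNFrom-E (suc zero) c D       = refl
nthNFrom-E (suc (suc i)) c D    = refl

nthNFrom-at : ∀ i c D {m} → nthNFrom i c D ≡ just m → ∃[ m' ] m ≡ m' + c × at D m' ≡ just N
nthNFrom-at (suc zero) c (N ∷ D) refl = 0 , refl , refl
nthNFrom-at (suc (suc i)) c (N ∷ D) found with nthNFrom-at (suc i) (suc c) D found
... | m' , refl , Dₘ≡N = suc m' , +-suc m' c , Dₘ≡N
nthNFrom-at i c (E ∷ D) found with nthNFrom-at i (suc c) D (trans (sym (nthNFrom-E i c D)) found)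
... | m' , refl , Dₘ≡N = suc m' , +-suc m' c , Dₘ≡N

nthN-at : ∀ i D {m} → nthN i D ≡ just m → at D m ≡ just N
nthN-at i D found with nthNFrom-at i 0 D found
... | m' , refl , Dₘ≡N = subst (λ m → at D m ≡ just N) (sym (+-identityʳ m')) Dₘ≡N

nthNFrom-≥ : ∀ i c D {m} → nthNFrom i c D ≡ just m → c ≤ m
nthNFrom-≥ i c D found with nthNFrom-at i c D found
... | m' , refl , _ = m≤n+m c m'

nthNFrom-injective : ∀ i i' c D {m} → nthNFrom i c D ≡ just m → nthNFrom i' c D ≡ just m → i ≡ i'
nthNFrom-injective (suc zero) (suc zero) c D _ _ = refl
nthNFrom-injective (suc zero) (suc (suc i')) c (N ∷ D) refl found' =
  ⊥-elim (n≮n c (nthNFrom-≥ (suc i') (suc c) D found'))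
nthNFrom-injective (suc (suc i)) (suc zero) c (N ∷ D) found refl =
  ⊥-elim (n≮n c (nthNFrom-≥ (suc i) (suc c) D found))
nthNFrom-injective (suc (suc i)) (suc (suc i')) c (N ∷ D) found found' =
  cong suc (nthNFrom-injective (suc i) (suc i') (suc c) D found found')
nthNFrom-injective i i' c (E ∷ D) found found' =
  nthNFrom-injective i i' (suc c) D (trans (sym (nthNFrom-E i c D)) found)
                                    (trans (sym (nthNFrom-E i' c D)) found')

module _ {A : Set} where

  at-take++ : ∀ (xs ys : List A) n {a} → at xs n ≡ just a → at (take n xs ++ ys) n ≡ at ys 0
  at-take++ (x ∷ xs) ys zero    _   = refl
  at-take++ (x ∷ xs) ys (suc n) xₙ = at-take++ xs ys n xₙ

  at-take++-< : ∀ (xs ys : List A) {n i a} → i < n → at xs n ≡ just a → at (take n xs ++ ys) i ≡ at xs i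
  at-take++-< (x ∷ xs) ys {suc n} {zero}  _         _  = refl
  at-take++-< (x ∷ xs) ys {suc n} {suc i} (s≤s i<n) xₙ = at-take++-< xs ys i<n xₙ

  at-drop-take++ : ∀ (xs zs : List A) {n k a} → n < k → at xs n ≡ just a → at (drop n (take k xs) ++ zs) 0 ≡ just a
  at-drop-take++ (x ∷ xs) zs {zero}  {suc k} _         xₙ = xₙ
  at-drop-take++ (x ∷ xs) zs {suc n} {suc k} (s≤s n<k) xₙ = at-drop-take++ xs zs n<k xₙ

-- With j the position of the east step before r_i^D and k that of t_i^D, this is D↑i = dtEf.
rotateAt : Path → ℕ → ℕ → Path
rotateAt D j k = take j D ++ drop (suc j) (take k D) ++ (E ∷ drop k D)

rotateAt-at : ∀ D {j k} → at D j ≡ just E → at D (suc j) ≡ just N → suc j < k → at (rotateAt D j k) j ≡ just N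
rotateAt-at D {j} {k} Dⱼ≡E Dⱼ₊₁≡N j<k =
  trans (at-take++ D _ j Dⱼ≡E) (at-drop-take++ D (E ∷ drop k D) j<k Dⱼ₊₁≡N)

rotateAt-at-< : ∀ D {i j k} → i < j → at D j ≡ just E → at (rotateAt D j k) i ≡ at D i
rotateAt-at-< D i<j Dⱼ≡E = at-take++-< D _ i<j Dⱼ≡E

rotateAt-position-≤ : ∀ D {j k j' k'} → at D j ≡ just E → at D (suc j) ≡ just N → suc j < k →
                      at D j' ≡ just E → rotateAt D j k ≡ rotateAt D j' k' → j' ≤ j
rotateAt-position-≤ D {j} {k} {j'} {k'} Dⱼ≡E Dⱼ₊₁≡N j<k Dⱼ'≡E same = ≮⇒≥ λ j<j' → N≢E (begin
  just N                  ≡⟨ rotateAt-at D Dⱼ≡E Dⱼ₊₁≡N j<k ⟨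
  at (rotateAt D j k) j   ≡⟨ cong (λ P → at P j) same ⟩
  at (rotateAt D j' k') j ≡⟨ rotateAt-at-< D {k = k'} j<j' Dⱼ'≡E ⟩
  at D j                  ≡⟨ Dⱼ≡E ⟩
  just E                  ∎)
  where
  open ≡-Reasoning
  N≢E : just N ≢ just E
  N≢E ()

data RotationView (D : Path) (i : ℕ) : Bool → Maybe Path → Set where
  undefined : RotationView D i false nothing
  defined   : ∀ {j k} → nthN i D ≡ just (suc j) → at D j ≡ just E → at D (suc j) ≡ just N → suc j < k →
              RotationView D i true (just (rotateAt D j k))

rotationView : ∀ ν D → numN D ≡ numN ν → numE D ≡ numE ν →
               ∀ i → RotationView D i (precededByE D i) (rotate ν D i)
rotationView ν D eN eE i with nthN i D in rᵢ
... | nothing     = undefined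
... | just zero   = undefined
... | just (suc j) with at D j in Dⱼ
...   | nothing = undefined
...   | just N  = undefined
...   | just E with touchIndex-after-N ν D (suc j) (nthN-at i D rᵢ) eE eN
...     | k , tᵢ , j<k rewrite tᵢ = defined rᵢ Dⱼ (nthN-at i D rᵢ) j<k

RotationView-is-just : ∀ {D i b r} → RotationView D i b r → b ≡ is-just r
RotationView-is-just undefined         = refl
RotationView-is-just (defined _ _ _ _) = refl

RotationView-injective : ∀ {D a a' b b' r r' P} → RotationView D a b r → RotationView D a' b' r' →
                         r ≡ just P → r' ≡ just P → a ≡ a'
RotationView-injective {D} {a} {a'}
  (defined {j} {k} rₐ Dⱼ≡E Dⱼ₊₁≡N j<k) (defined {j'} {k'} rₐ' Dⱼ'≡E Dⱼ'₊₁≡N j'<k') r≡ r'≡ =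
  nthNFrom-injective a a' 0 D rₐ (subst (λ m → nthN a' D ≡ just (suc m)) (sym j≡j') rₐ')
  where
  same : rotateAt D j k ≡ rotateAt D j' k'
  same = just-injective (trans r≡ (sym r'≡))
  j≡j' : j ≡ j'
  j≡j' = ≤-antisym (rotateAt-position-≤ D {k = k'} {k' = k} Dⱼ'≡E Dⱼ'₊₁≡N j'<k' Dⱼ≡E (sym same))
                   (rotateAt-position-≤ D {k = k} {k' = k'} Dⱼ≡E Dⱼ₊₁≡N j<k Dⱼ'≡E same)

module _ {A B : Set} (f : A → Maybe B) where

  length-mapMaybe≡length-filterᵇ : (g : A → Bool) → (∀ x → g x ≡ is-just (f x)) →
                                   ∀ xs → length (mapMaybe f xs) ≡ length (filterᵇ g xs)
  length-mapMaybe≡length-filterᵇ g g≡ [] = refl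
  length-mapMaybe≡length-filterᵇ g g≡ (x ∷ xs) with f x | g x | g≡ x
  ... | just _  | .true  | refl = cong suc (length-mapMaybe≡length-filterᵇ g g≡ xs)
  ... | nothing | .false | refl = length-mapMaybe≡length-filterᵇ g g≡ xs

  Unique-mapMaybe : (∀ {a a' b} → f a ≡ just b → f a' ≡ just b → a ≡ a') →
                    ∀ {xs} → Unique xs → Unique (mapMaybe f xs)
  Unique-mapMaybe f-inj {[]} [] = []
  Unique-mapMaybe f-inj {x ∷ xs} (x∉xs ∷ xs!) with f x in fx
  ... | nothing = Unique-mapMaybe f-inj xs!
  ... | just b  = b∉ x∉xs ∷ Unique-mapMaybe f-inj xs!
    where
    b∉ : ∀ {ys} → All (x ≢_) ys → All (b ≢_) (mapMaybe f ys)
    b∉ {[]}     []           = []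
    b∉ {y ∷ ys} (x≢y ∷ x∉ys) with f y in fy
    ... | nothing = b∉ x∉ys
    ... | just _  = (λ { refl → x≢y (f-inj fx fy) }) ∷ b∉ x∉ys

deduplicate-Unique : ∀ {A : Set} (_≟_ : DecidableEquality A) {xs} → Unique xs → deduplicate _≟_ xs ≡ xs
deduplicate-Unique _≟_ {[]} [] = refl
deduplicate-Unique _≟_ {x ∷ xs} (x∉xs ∷ xs!) = cong (x ∷_) (begin
  filter (¬? ∘ (x ≟_)) (deduplicate _≟_ xs) ≡⟨ cong (filter (¬? ∘ (x ≟_))) (deduplicate-Unique _≟_ xs!) ⟩
  filter (¬? ∘ (x ≟_)) xs                   ≡⟨ filter-all (¬? ∘ (x ≟_)) x∉xs ⟩
  xs                                        ∎)
  where open ≡-Reasoning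

outDegree≡numEastPreceded : ∀ ν D → numN D ≡ numN ν → numE D ≡ numE ν → outDegree ν D ≡ numEastPreceded ν D
outDegree≡numEastPreceded ν D eN eE = begin
  length (deduplicate _≟P_ (mapMaybe (rotate ν D) (indices ν)))
    ≡⟨ cong length (deduplicate-Unique _≟P_ (Unique-mapMaybe (rotate ν D) rotate-injective indices!)) ⟩
  length (mapMaybe (rotate ν D) (indices ν))
    ≡⟨ length-mapMaybe≡length-filterᵇ (rotate ν D) (precededByE D)
         (λ i → RotationView-is-just (view i)) (indices ν) ⟩
  length (filterᵇ (precededByE D) (indices ν)) ∎
  where
  open ≡-Reasoning
  view : ∀ i → RotationView D i (precededByE D i) (rotate ν D i)
  view = rotationView ν D eN eE
  rotate-injective : ∀ {a a' P} → rotate ν D a ≡ just P → rotate ν D a' ≡ just P → a ≡ a'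
  rotate-injective = RotationView-injective (view _) (view _)
  indices! : Unique (indices ν)
  indices! = Unique.map⁺ suc-injective (Unique.upTo⁺ (numN ν))

mainTheorem3 : (ν D : Path) (σ : ℕ) → IsDyck ν D → IsSigma ν σ →
    (outDegree ν D ≡ σ) ⇔ (numEastPreceded ν D ≡ σ)
mainTheorem3 ν D σ (eN , eE , _) _ = mk⇔ (trans (sym outDegree≡)) (trans outDegree≡)
  where
  outDegree≡ : outDegree ν D ≡ numEastPreceded ν D
  outDegree≡ = outDegree≡numEastPreceded ν D eN eE
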